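{- Let $M$ be a fair Kripke structure and $M_{L2S}$ its liveness-to-safety transformation. Then $M$ has an initialised fair path if and only if there exists $k\in\mathbb{N}$ such that $[\![M_{L2S}]\!]_k\wedge\mathit{LoopClosed}(\tilde{s}_k)$ is satisfiable.
   Context: A fair Kripke structure $M=(S,T,I,L,F=\{F_0,\dots,F_f\})$ has finite state set $S$, total transition relation $T\subseteq S\times S$, initial states $I$, labelling $L$, acceptance sets $F_m\subseteq S$; an infinite path $s_0s_1\ldots$ is initialised if $s_0\in I$ and fair if it visits each $F_m$ infinitely often. With the states of $M$ regarded as values of a variable $v$ with range $S$, $M_{L2S}=(S_{L2S},T_{L2S},I_{L2S},L_{L2S})$ has state variables $v,\hat v$ (range $S$) and Booleans $l_s,\mathit{InLoop},\mathit{LoopClosed},Acc_m$ ($0\le m\le f$); $S_{L2S},I_{L2S},T_{L2S}$ are the largest sets satisfying: (states) $v\in S$, $\mathit{LoopClosed}\Rightarrow\mathit{InLoop}$, $\mathit{LoopClosed}\Rightarrow v=\hat v$, $\mathit{LoopClosed}\Rightarrow Acc_m$ for all $m$; (initial) state constraints, $v\in I$, $l_s=\mathit{InLoop}=\bot$, $Acc_m=\bot$; (transitions, primes denoting next state) both states in $S_{L2S}$, $(v,v')\in T$, $\mathit{InLoop}'\Leftrightarrow\mathit{InLoop}\vee l_s'$, $\mathit{InLoop}\Rightarrow\neg l_s'$, $(l_s'\Rightarrow\hat v'=v)\wedge(\neg l_s'\Rightarrow\hat v'=\hat v)$, $Acc_m'\Leftrightarrow Acc_m\vee(\mathit{InLoop}'\wedge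 v'\in F_m)$. For bound $k$, $[\![M_{L2S}]\!]_k=I_{L2S}(\tilde s_0)\wedge\bigwedge_{i=1}^kT_{L2S}(\tilde s_{i-1},\tilde s_i)$ over propositional copies $\tilde s_0,\dots,\tilde s_k$ of the state variables of $M_{L2S}$ (each ranging over $S_{L2S}$). -}

module Defs where

open import Level using (0ℓ)
open import Data.Nat using (ℕ; zero; suc; _≤_)
open import Data.Fin using (Fin; zero; suc; fromℕ; inject₁)
open import Data.Fin.Subset using (Subset; _∈_)
open import Data.Vec using (lookup)
open import Data.Bool using (Bool; true; false; T; _∨_; _∧_)
open import Data.Product using (Σ; ∃; _×_; _,_)
open import Relation.Binary using (Rel)
open import Relation.Binary.PropositionalEquality using (_≡_)

record FairKripke (AP : Set) : Set₁ where
  field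
    n     : ℕ
    f     : ℕ
    Tr    : Rel (Fin n) 0ℓ
    total : ∀ s → ∃ λ s′ → Tr s s′
    I     : Subset n
    L     : Fin n → AP → Bool
    F     : Fin (suc f) → Subset n

module _ {AP : Set} (M : FairKripke AP) where
  open FairKripke M

  IsInitFairPath : (ℕ → Fin n) → Set
  IsInitFairPath π =
    (π 0 ∈ I) ×
    (∀ i → Tr (π i) (π (suc i))) ×
    (∀ (m : Fin (suc f)) (i : ℕ) → ∃ λ j → i ≤ j × π j ∈ F m)

  HasInitFairPath : Set
  HasInitFairPath = ∃ λ π → IsInitFairPath π

  record L2SState : Set where
    constructor l2s
    field
      v          : Fin n
      v̂          : Fin n
      ls         : Bool
      InLoop     : Bool
      LoopClosed : Bool
      Acc        : Fin (suc f) → Bool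
  open L2SState public

  _⇒ᵇ_ : Bool → Bool → Set
  a ⇒ᵇ b = T a → T b

  _⇔ᵇ_ : Bool → Bool → Set
  a ⇔ᵇ b = (T a → T b) × (T b → T a)

  -- S_L2S  (the constraint v ∈ S is implicit in the type Fin n)
  StateL2S : L2SState → Set
  StateL2S s =
    (LoopClosed s ⇒ᵇ InLoop s) ×
    (T (LoopClosed s) → v s ≡ v̂ s) ×
    (∀ m → LoopClosed s ⇒ᵇ Acc s m)

  InitL2S : L2SState → Set
  InitL2S s =
    StateL2S s × (v s ∈ I) × (ls s ≡ false) × (InLoop s ≡ false) ×
    (∀ m → Acc s m ≡ false)

  TransL2S : L2SState → L2SState → Set
  TransL2S s s′ =
    StateL2S s × StateL2S s′ ×
    Tr (v s) (v s′) ×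
    (InLoop s′ ⇔ᵇ (InLoop s ∨ ls s′)) ×
    (InLoop s ⇒ᵇ Data.Bool.not (ls s′)) ×
    (T (ls s′) → v̂ s′ ≡ v s) ×
    (T (Data.Bool.not (ls s′)) → v̂ s′ ≡ v̂ s) ×
    (∀ m → Acc s′ m ⇔ᵇ (Acc s m ∨ (InLoop s′ ∧ lookup (F m) (v s′))))
    where import Data.Bool

  Unroll : (k : ℕ) → (Fin (suc k) → L2SState) → Set
  Unroll k s̃ = InitL2S (s̃ zero) × (∀ (i : Fin k) → TransL2S (s̃ (inject₁ i)) (s̃ (suc i)))

  SatLoopClosed : ℕ → Set
  SatLoopClosed k = ∃ λ (s̃ : Fin (suc k) → L2SState) →
    Unroll k s̃ × T (LoopClosed (s̃ (fromℕ k)))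

{-# OPTIONS --safe #-}
-- Along a fair path π choose checkpoints 0 = c₀ < c₁ < … such that every
-- acceptance set is visited between consecutive ones.  The state set is finite,
-- so two checkpoints J < K carry the same state, and setting l_s at J + 1 and
-- LoopClosed at K turns π 0 … π K into a run of M_L2S.  Conversely, along a run
-- of M_L2S, v̂ holds the state of the step before l_s was set and Acc_m records a
-- visit to F_m since then; so a run ending in LoopClosed yields a finite path
-- x 0 … x k with x k ≡ x j whose segment (j, k] visits every F_m, and repeating
-- x j … x (k − 1) forever gives a fair path.
module Submission where

open import Defs
open import Data.Nat using (ℕ; zero; suc; _+_; _∸_; _⊔_; _≤_; _<_; _≤′_; ≤′-refl; ≤′-step; z≤n; z<s; s≤s; _<ᵇ_; _≡ᵇ_; >-nonZero)
open import Data.Nat.Properties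
open import Data.Fin using (Fin; zero; suc; toℕ; fromℕ<; inject₁)
open import Data.Fin.Properties using (pigeonhole; toℕ-inject₁; toℕ-fromℕ; toℕ-fromℕ<; toℕ<n)
open import Data.Fin.Subset using (Subset; _∈_)
open import Data.Vec using (lookup)
open import Data.Vec.Properties using ([]=⇒lookup; lookup⇒[]=)
open import Data.Bool using (Bool; false; T; not; _∨_; _∧_)
open import Data.Bool.Properties using (T-≡; T-∨; T-∧)
open import Data.Empty using (⊥-elim)
open import Data.Sum using (_⊎_; inj₁; inj₂; [_,_]′)
import Data.Sum as Sum
open import Data.Product using (∃; _×_; _,_; proj₁; proj₂; ∃₂)
import Data.Product as Product
open import Function.Base using (_∘_; id)
open import Function.Bundles using (_⇔_; mk⇔)
open Function.Bundles.Equivalence using (to; from)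
open import Relation.Binary using (Rel)
open import Relation.Nullary using (¬_; yes; no; contradiction)
open import Relation.Nullary.Decidable using (T?)
open import Relation.Binary.PropositionalEquality using (_≡_; refl; sym; trans; cong; subst; subst₂)

stepwise⇒monotone : ∀ (g : ℕ → ℕ) → (∀ t → g t ≤ g (suc t)) → ∀ {a b} → a ≤ b → g a ≤ g b
stepwise⇒monotone g step a≤b = go (≤⇒≤′ a≤b)
  where
  go : ∀ {a b} → a ≤′ b → g a ≤ g b
  go ≤′-refl        = ≤-refl
  go (≤′-step a≤′b) = ≤-trans (go a≤′b) (step _)

common-bound : ∀ {k} (P : Fin k → ℕ → Set) → (∀ m {a b} → a ≤ b → P m a → P m b) →
               (∀ m → ∃ (P m)) → ∃ λ N → ∀ m → P m N
common-bound {zero}  P up holds = 0 , λ ()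
common-bound {suc k} P up holds =
  let N₀ , p₀ = holds zero
      N₁ , p₁ = common-bound (P ∘ suc) (up ∘ suc) (holds ∘ suc)
  in N₀ ⊔ N₁ , λ { zero    → up zero (m≤m⊔n N₀ N₁) p₀
                 ; (suc m) → up (suc m) (m≤n⊔m N₀ N₁) (p₁ m) }

repeats : ∀ {n} (g : ℕ → Fin n) → ∃₂ λ a b → a < b × g a ≡ g b
repeats {n} g =
  let i , j , i<j , gi≡gj = pigeonhole (n<1+n n) (g ∘ toℕ)
  in toℕ i , toℕ j , i<j , gi≡gj

clamp : ∀ {k} → ℕ → Fin (suc k)
clamp             zero    = zero
clamp {k = zero}  (suc t) = zero
clamp {k = suc k} (suc t) = suc (clamp t)

clamp-toℕ : ∀ {k} (i : Fin (suc k)) → clamp (toℕ i) ≡ i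
clamp-toℕ             zero    = refl
clamp-toℕ {k = suc k} (suc i) = cong suc (clamp-toℕ i)

toℕ⇒clamp : ∀ {k t} {i : Fin (suc k)} → toℕ i ≡ t → clamp t ≡ i
toℕ⇒clamp {i = i} refl = clamp-toℕ i

∈⇒T-lookup : ∀ {n} {x : Fin n} {p : Subset n} → x ∈ p → T (lookup p x)
∈⇒T-lookup x∈p = from T-≡ ([]=⇒lookup x∈p)

T-lookup⇒∈ : ∀ {n} {x : Fin n} {p : Subset n} → T (lookup p x) → x ∈ p
T-lookup⇒∈ {x = x} {p} h = lookup⇒[]= x p (to T-≡ h)

<ᵇ-suc : ∀ m n → (m <ᵇ suc n) ≡ ((m <ᵇ n) ∨ (m ≡ᵇ n))
<ᵇ-suc zero    zero    = refl
<ᵇ-suc zero    (suc n) = refl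
<ᵇ-suc (suc m) zero    = refl
<ᵇ-suc (suc m) (suc n) = <ᵇ-suc m n

<ᵇ⇒not-≡ᵇ : ∀ m n → T (m <ᵇ n) → T (not (m ≡ᵇ n))
<ᵇ⇒not-≡ᵇ zero    (suc n) _ = _
<ᵇ⇒not-≡ᵇ (suc m) (suc n) h = <ᵇ⇒not-≡ᵇ m n h

module _ {A : Set} (x : ℕ → A) where

  InfinitelyOften : (A → Set) → Set
  InfinitelyOften P = ∀ i → ∃ λ j → i ≤ j × P (x j)

  record Visits (P : A → Set) (i k : ℕ) : Set where
    constructor visit
    field
      time  : ℕ
      after : i < time
      by    : time ≤ k
      hit   : P (x time)

  record CoveringLoop {c} (P : Fin c → A → Set) (j k : ℕ) : Set where
    field
      closes : x k ≡ x j
      covers : ∀ m → Visits (P m) j k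

  Visits-extend : ∀ {P i k k′} → k ≤ k′ → Visits P i k → Visits P i k′
  Visits-extend k≤k′ (visit w i<w w≤k p) = visit w i<w (≤-trans w≤k k≤k′) p

  Visits⇒< : ∀ {P i k} → Visits P i k → i < k
  Visits⇒< (visit w i<w w≤k _) = <-≤-trans i<w w≤k

  infinitelyOften⇒Visits : ∀ {P} → InfinitelyOften P → ∀ i → ∃ (Visits P i)
  infinitelyOften⇒Visits often i =
    let w , i<w , p = often (suc i) in w , visit w i<w ≤-refl p

infinitelyOften⇒coveringLoop : ∀ {n c} (x : ℕ → Fin n) (P : Fin (suc c) → Fin n → Set) →
                               (∀ m → InfinitelyOften x (P m)) → ∃₂ (CoveringLoop x P)
infinitelyOften⇒coveringLoop x P often =
  let a , b , a<b , same = repeats (x ∘ checkpoint)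
  in checkpoint a , checkpoint b , record { closes = sym same ; covers = visits-between a<b }
  where
  visits-after : ∀ i → ∃ λ N → ∀ m → Visits x (P m) i N
  visits-after i = common-bound (λ m → Visits x (P m) i) (λ m → Visits-extend x)
                                (λ m → infinitelyOften⇒Visits x (often m) i)

  checkpoint : ℕ → ℕ
  checkpoint zero    = 0
  checkpoint (suc t) = proj₁ (visits-after (checkpoint t))

  checkpoint-visits : ∀ t m → Visits x (P m) (checkpoint t) (checkpoint (suc t))
  checkpoint-visits t = proj₂ (visits-after (checkpoint t))

  checkpoint-mono : ∀ {a b} → a ≤ b → checkpoint a ≤ checkpoint b
  checkpoint-mono =
    stepwise⇒monotone checkpoint (λ t → <⇒≤ (Visits⇒< x (checkpoint-visits t zero)))

  visits-between : ∀ {a b} → a < b → ∀ m → Visits x (P m) (checkpoint a) (checkpoint b)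
  visits-between {a} a<b m = Visits-extend x (checkpoint-mono a<b) (checkpoint-visits a m)

module Lasso (j k : ℕ) (j<k : j < k) where

  -- unwind t is the index in the prefix x 0 … x k of the lasso's state at
  -- time t; after k − 1 it jumps back to j, a legal step when x k ≡ x j.
  step : ℕ → ℕ
  step r with suc r <? k
  ... | yes _ = suc r
  ... | no  _ = j

  unwind : ℕ → ℕ
  unwind zero    = 0
  unwind (suc t) = step (unwind t)

  step-< : ∀ r → step r < k
  step-< r with suc r <? k
  ... | yes r+1<k = r+1<k
  ... | no  _     = j<k

  step-suc : ∀ {r} → suc r < k → step r ≡ suc r
  step-suc {r} r+1<k with suc r <? k
  ... | yes _     = refl
  ... | no  r+1≮k = contradiction r+1<k r+1≮k

  step-wrap : ∀ {r} → suc r ≡ k → step r ≡ j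
  step-wrap {r} r+1≡k with suc r <? k
  ... | yes r+1<k = contradiction r+1≡k (<⇒≢ r+1<k)
  ... | no  _     = refl

  0<k : 0 < k
  0<k = <-≤-trans z<s j<k

  unwind-< : ∀ t → unwind t < k
  unwind-< zero    = 0<k
  unwind-< (suc t) = step-< (unwind t)

  unwind-prefix : ∀ {t} → t < k → unwind t ≡ t
  unwind-prefix {zero}  _     = refl
  unwind-prefix {suc t} t+1<k =
    trans (cong step (unwind-prefix (<-trans (n<1+n t) t+1<k))) (step-suc t+1<k)

  unwind-closes : unwind k ≡ j
  unwind-closes = closes-at (suc-pred k {{>-nonZero 0<k}})
    where
    closes-at : ∀ {t} → suc t ≡ k → unwind k ≡ j
    closes-at {t} refl = trans (cong step (unwind-prefix (n<1+n t))) (step-wrap refl)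

  unwind-periodic : ∀ d → unwind (d + k) ≡ unwind (d + j)
  unwind-periodic zero    = trans unwind-closes (sym (unwind-prefix j<k))
  unwind-periodic (suc d) = cong step (unwind-periodic d)

  unwind-next-period : ∀ {l} → j ≤ l → unwind (l ∸ j + k) ≡ unwind l
  unwind-next-period {l} j≤l = trans (unwind-periodic (l ∸ j)) (cong unwind (m∸n+n≡m j≤l))

  <-next-period : ∀ {l} → j ≤ l → l < l ∸ j + k
  <-next-period {l} j≤l = subst (_< l ∸ j + k) (m∸n+n≡m j≤l) (+-monoʳ-< (l ∸ j) j<k)

  unwind-recurrent : ∀ {c} → j ≤ c → c < k → ∀ i → ∃ λ l → i ≤ l × j ≤ l × unwind l ≡ c
  unwind-recurrent j≤c c<k zero    = _ , z≤n , j≤c , unwind-prefix c<k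
  unwind-recurrent j≤c c<k (suc i) =
    let l , i≤l , j≤l , unwound≡c = unwind-recurrent j≤c c<k i
    in l ∸ j + k , ≤-<-trans i≤l (<-next-period j≤l)
     , ≤-trans j≤l (<⇒≤ (<-next-period j≤l)) , trans (unwind-next-period j≤l) unwound≡c

  lasso-steps : ∀ {a ℓ} {A : Set a} (R : Rel A ℓ) (x : ℕ → A) → x k ≡ x j →
                (∀ t → t < k → R (x t) (x (suc t))) →
                ∀ t → R (x (unwind t)) (x (unwind (suc t)))
  lasso-steps R x closes steps t = step-edge (unwind t) (unwind-< t)
    where
    step-edge : ∀ r → r < k → R (x r) (x (step r))
    step-edge r r<k with suc r <? k
    ... | yes _     = steps r r<k
    ... | no  r+1≮k = subst (R (x r)) (trans (cong x (≤-antisym r<k (≮⇒≥ r+1≮k))) closes)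
                            (steps r r<k)

  lasso-recurrent : ∀ {a} {A : Set a} (x : ℕ → A) → x k ≡ x j → ∀ {w} → j ≤ w → w ≤ k →
                    ∀ i → ∃ λ l → i ≤ l × x (unwind l) ≡ x w
  lasso-recurrent x closes j≤w w≤k i with m≤n⇒m<n∨m≡n w≤k
  ... | inj₁ w<k  = let l , i≤l , _ , unwound≡w = unwind-recurrent j≤w w<k i
                    in l , i≤l , cong x unwound≡w
  ... | inj₂ refl = let l , i≤l , _ , unwound≡j = unwind-recurrent ≤-refl j<k i
                    in l , i≤l , trans (cong x unwound≡j) (sym closes)

module LivenessToSafety {AP : Set} (M : FairKripke AP) where
  open FairKripke M

  FairLoop : (ℕ → Fin n) → ℕ → ℕ → Set
  FairLoop x = CoveringLoop x (λ m s → s ∈ F m)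

  record InitPrefix (k : ℕ) (x : ℕ → Fin n) : Set where
    field
      start : x 0 ∈ I
      steps : ∀ t → t < k → Tr (x t) (x (suc t))

  record Run (k : ℕ) (u : ℕ → L2SState M) : Set where
    field
      init  : InitL2S M (u 0)
      steps : ∀ t → t < k → TransL2S M (u t) (u (suc t))

  run⇒satLoopClosed : ∀ {k u} → Run k u → T (LoopClosed (u k)) → SatLoopClosed M k
  run⇒satLoopClosed {k} {u} run closed =
    u ∘ toℕ , (init , step-at) , subst (T ∘ LoopClosed ∘ u) (sym (toℕ-fromℕ k)) closed
    where
    open Run run
    step-at : ∀ (i : Fin k) → TransL2S M (u (toℕ (inject₁ i))) (u (suc (toℕ i)))
    step-at i rewrite toℕ-inject₁ i = steps (toℕ i) (toℕ<n i)

  satLoopClosed⇒run : ∀ {k} → SatLoopClosed M k → ∃ λ u → Run k u × T (LoopClosed (u k))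
  satLoopClosed⇒run {k} (s̃ , (init , steps) , closed) =
    s̃ ∘ clamp , record { init = init ; steps = step-at }
    , subst (T ∘ LoopClosed ∘ s̃) (sym (toℕ⇒clamp (toℕ-fromℕ k))) closed
    where
    step-at : ∀ t → t < k → TransL2S M (s̃ (clamp t)) (s̃ (clamp (suc t)))
    step-at t t<k =
      subst₂ (λ a b → TransL2S M (s̃ a) (s̃ b))
             (sym (toℕ⇒clamp (trans (toℕ-inject₁ i) (toℕ-fromℕ< t<k))))
             (sym (toℕ⇒clamp (cong suc (toℕ-fromℕ< t<k))))
             (steps i)
      where i = fromℕ< t<k

  -- l_s is set at J + 1 and LoopClosed at K; v̂ is π J from the start,
  -- its value before the loop being unconstrained.
  module CanonicalRun (π : ℕ → Fin n) {J K : ℕ} (loop : FairLoop π J K) where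
    open CoveringLoop loop

    acc : ℕ → Fin (suc f) → Bool
    acc zero    m = false
    acc (suc t) m = acc t m ∨ ((J <ᵇ suc t) ∧ lookup (F m) (π (suc t)))

    run : ℕ → L2SState M
    run t = l2s (π t) (π J) (suc J ≡ᵇ t) (J <ᵇ t) (t ≡ᵇ K) (acc t)

    acc-visits : ∀ {t m} → Visits π (_∈ F m) J t → T (acc t m)
    acc-visits {zero}  (visit _ () z≤n _)
    acc-visits {suc t} (visit w J<w w≤t+1 w∈F) with m≤n⇒m<n∨m≡n w≤t+1
    ... | inj₁ w<t+1 = from T-∨ (inj₁ (acc-visits (visit w J<w (m<1+n⇒m≤n w<t+1) w∈F)))
    ... | inj₂ refl  = from T-∨ (inj₂ (from T-∧ (<⇒<ᵇ J<w , ∈⇒T-lookup w∈F)))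

    run-state : ∀ t → StateL2S M (run t)
    run-state t = (λ c → subst (T ∘ (J <ᵇ_)) (sym (at-K c)) (<⇒<ᵇ (Visits⇒< π (covers zero))))
                , (λ c → trans (cong π (at-K c)) closes)
                , (λ m c → subst (λ t → T (acc t m)) (sym (at-K c)) (acc-visits (covers m)))
      where
      at-K : T (t ≡ᵇ K) → t ≡ K
      at-K = ≡ᵇ⇒≡ t K

    run-step : ∀ t → Tr (π t) (π (suc t)) → TransL2S M (run t) (run (suc t))
    run-step t tr = run-state t , run-state (suc t) , tr
                  , (subst T (<ᵇ-suc J t) , subst T (sym (<ᵇ-suc J t)))
                  , <ᵇ⇒not-≡ᵇ J t
                  , (λ entering → cong π (≡ᵇ⇒≡ J t entering))
                  , (λ _ → refl)
                  , (λ m → id , id)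

    run-is-run : π 0 ∈ I → (∀ t → Tr (π t) (π (suc t))) → Run K run
    run-is-run π₀∈I tr = record
      { init  = run-state 0 , π₀∈I , refl , refl , (λ _ → refl)
      ; steps = λ t _ → run-step t (tr t)
      }

    run-closed : T (LoopClosed (run K))
    run-closed = ≡⇒≡ᵇ K K refl

  acc-step : ∀ {s s′} → TransL2S M s s′ → ∀ m → T (Acc s′ m) →
             T (Acc s m) ⊎ (T (InLoop s′) × v s′ ∈ F m)
  acc-step (_ , _ , _ , _ , _ , _ , _ , acc⇔) m acc′ =
    Sum.map₂ (Product.map₂ T-lookup⇒∈ ∘ to T-∧) (to T-∨ (proj₁ (acc⇔ m) acc′))

  module _ (u : ℕ → L2SState M) where

    AccVisited : ℕ → ℕ → Set
    AccVisited j t = ∀ m → T (Acc (u t) m) → Visits (v ∘ u) (_∈ F m) j t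

    accVisited-step : ∀ {j t} → TransL2S M (u t) (u (suc t)) → j ≤ t →
                      AccVisited j t → AccVisited j (suc t)
    accVisited-step {t = t} tr j≤t visited m acc′ with acc-step {u t} {u (suc t)} tr m acc′
    ... | inj₁ acc       = Visits-extend (v ∘ u) (n≤1+n t) (visited m acc)
    ... | inj₂ (_ , v∈F) = visit (suc t) (s≤s j≤t) ≤-refl v∈F

    LoopInvariant : ℕ → Set
    LoopInvariant t =
      (¬ T (InLoop (u t)) → ∀ m → ¬ T (Acc (u t) m)) ×
      (T (InLoop (u t)) → ∃ λ j → j < t × v̂ (u t) ≡ v (u j) × AccVisited j t)

    loopInvariant-init : InitL2S M (u 0) → LoopInvariant 0
    loopInvariant-init (_ , _ , _ , inLoop≡false , acc≡false) =
      (λ _ m acc → subst T (acc≡false m) acc) , (λ inLoop → ⊥-elim (subst T inLoop≡false inLoop))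

    loopInvariant-step : ∀ {t} → TransL2S M (u t) (u (suc t)) →
                         LoopInvariant t → LoopInvariant (suc t)
    loopInvariant-step {t}
      tr@(_ , _ , _ , (inLoop′⇒ , ⇒inLoop′) , inLoop⇒¬ls′ , ls′⇒v̂′ , ¬ls′⇒v̂′ , _) (outside , inside) =
      outside′ , inside′
      where
      outside′ : ¬ T (InLoop (u (suc t))) → ∀ m → ¬ T (Acc (u (suc t)) m)
      outside′ ¬inLoop′ m acc′ with acc-step {u t} {u (suc t)} tr m acc′
      ... | inj₁ acc           = outside (¬inLoop′ ∘ ⇒inLoop′ ∘ from T-∨ ∘ inj₁) m acc
      ... | inj₂ (inLoop′ , _) = ¬inLoop′ inLoop′

      inside′ : T (InLoop (u (suc t))) →
                ∃ λ j → j < suc t × v̂ (u (suc t)) ≡ v (u j) × AccVisited j (suc t)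
      inside′ inLoop′ with T? (InLoop (u t))
      ... | yes inLoop =
        let j , j<t , v̂≡vj , visited = inside inLoop
        in j , m<n⇒m<1+n j<t , trans (¬ls′⇒v̂′ (inLoop⇒¬ls′ inLoop)) v̂≡vj
         , accVisited-step tr (<⇒≤ j<t) visited
      ... | no ¬inLoop =
        t , ≤-refl , ls′⇒v̂′ entering
          , accVisited-step tr ≤-refl (λ m acc → contradiction acc (outside ¬inLoop m))
        where
        entering : T (ls (u (suc t)))
        entering = [ ⊥-elim ∘ ¬inLoop , id ]′ (to T-∨ (inLoop′⇒ inLoop′))

  run-invariant : ∀ {k u} → Run k u → ∀ {t} → t ≤ k → LoopInvariant u t
  run-invariant {u = u} run {zero}  _   = loopInvariant-init u (Run.init run)
  run-invariant {u = u} run {suc t} t<k =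
    loopInvariant-step u (Run.steps run t t<k) (run-invariant run (<⇒≤ t<k))

  run-final-state : ∀ {k u} → Run k u → StateL2S M (u k)
  run-final-state {zero}  run = proj₁ (Run.init run)
  run-final-state {suc k} run = proj₁ (proj₂ (Run.steps run k ≤-refl))

  run-trace : ∀ {k u} → Run k u → InitPrefix k (v ∘ u)
  run-trace run = record
    { start = proj₁ (proj₂ (Run.init run))
    ; steps = λ t t<k → proj₁ (proj₂ (proj₂ (Run.steps run t t<k)))
    }

  run⇒fairLoop : ∀ {k u} → Run k u → T (LoopClosed (u k)) → ∃ λ j → FairLoop (v ∘ u) j k
  run⇒fairLoop run closed =
    let closed⇒inLoop , closed⇒v≡v̂ , closed⇒acc = run-final-state run
        j , _ , v̂≡vj , visited = proj₂ (run-invariant run ≤-refl) (closed⇒inLoop closed)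
    in j , record { closes = trans (closed⇒v≡v̂ closed) v̂≡vj
                  ; covers = λ m → visited m (closed⇒acc m closed) }

  fairLoop⇒fairPath : ∀ {x j k} → InitPrefix k x → FairLoop x j k → HasInitFairPath M
  fairLoop⇒fairPath {x} {j} {k} prefix loop =
    x ∘ unwind , start , lasso-steps Tr x closes steps , fair
    where
    open InitPrefix prefix
    open CoveringLoop loop
    open Lasso j k (Visits⇒< x (covers zero))
    fair : ∀ m i → ∃ λ l → i ≤ l × x (unwind l) ∈ F m
    fair m i =
      let visit w j<w w≤k xw∈F = covers m
          l , i≤l , same = lasso-recurrent x closes (<⇒≤ j<w) w≤k i
      in l , i≤l , subst (_∈ F m) (sym same) xw∈F

corollary4p2 : {AP : Set} (M : FairKripke AP) →
    HasInitFairPath M ⇔ (∃ λ (k : ℕ) → SatLoopClosed M k)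
corollary4p2 M = mk⇔ fairPath⇒satLoopClosed satLoopClosed⇒fairPath
  where
  open FairKripke M
  open LivenessToSafety M

  fairPath⇒satLoopClosed : HasInitFairPath M → ∃ (SatLoopClosed M)
  fairPath⇒satLoopClosed (π , π₀∈I , steps , fair)
    with J , K , loop ← infinitelyOften⇒coveringLoop π (λ m s → s ∈ F m) fair =
    let open CanonicalRun π loop
    in K , run⇒satLoopClosed (run-is-run π₀∈I steps) run-closed

  satLoopClosed⇒fairPath : ∃ (SatLoopClosed M) → HasInitFairPath M
  satLoopClosed⇒fairPath (k , sat)
    with u , run , closed ← satLoopClosed⇒run sat
    with j , loop ← run⇒fairLoop run closed =
    fairLoop⇒fairPath (run-trace run) loop
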